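{- Let $nw=(a_1\dots a_n,\nu)\in\mathrm{NW}(\Delta)$, let $\Phi_\circ(nw)=([n],\lambda,\le_1^\circ,\le_2^\circ)$ and $\Phi_\bullet(nw)=([n],\lambda,\le_1^\bullet,\le_2^\bullet)$, and let $1\le i<j\le n$. Then the following are equivalent: (a) $i\ge_2^\circ j$; (b) $i\le_2^\bullet j$; (c) there is $(k,\ell)\in\nu$ with $1\le k\le i<j\le\ell\le n$ such that there is no $(k',\ell')\in\nu$ with $k<k'\le i<j\le\ell'<\ell$, and $k$ has odd nesting depth.
   Context: Nested words: $\Delta$ finite alphabet; a nesting relation of width $n$ is a binary relation $\nu$ on $[n]$ with $\nu(i,j)\Rightarrow i<j$; $\nu(i,j),\nu(i,j')\Rightarrow j=j'$; $\nu(i,j),\nu(i',j)\Rightarrow i=i'$; $\nu(i,j),\nu(i',j'),i<i'\Rightarrow j<i'$ or $j'<j$. A nested word is $(a_1\dots a_n,\nu)$ with $n\ge1$, $a_i\in\Delta$, $\nu$ a nesting relation of width $n$; $(i,j)\in\nu$ makes $i$ a call position. The nesting depth of a position $k$ is the number of pairs $(i,j)\in\nu$ with $i\le k<j$ (open call positions up to and including $k$). For $1\le k\le l\le n$, $nw[k,l]=(a_k\dots a_l,\{(p-k+1,q-k+1):(p,q)\in\nu,\ k\le p,q\le l\})$. Texts: a text is $(V,\lambda,\le_1,\le_2)$ with $V$ finite nonempty, $\lambda:V\to\Delta$, $\le_1,\le_2$ linear orders. For disjoint domains, $\tau\circ\tau'$ has $\le_1\cup\le_1'\cup V\times V'$ and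 $\le_2\cup\le_2'\cup V\times V'$; $\tau\bullet\tau'$ has the same first order and second order $\le_2\cup\le_2'\cup V'\times V$ (labels united). Encodings $\Phi_\circ,\Phi_\bullet$: if $\nu=\emptyset$, $\Phi_\circ(nw)=a_1\circ\dots\circ a_n$ and $\Phi_\bullet(nw)=a_1\bullet\dots\bullet a_n$ (letters as one-element texts). Otherwise let $i$ be the minimal call position, $(i,j)\in\nu$, $nw'=nw[i+1,j-1]$, $nw''=nw[j+1,n]$, and $\Phi_\circ(nw)=a_1\circ\dots\circ a_{i-1}\circ(a_i\bullet\Phi_\bullet(nw')\bullet a_j)\circ\Phi_\circ(nw'')$, $\Phi_\bullet(nw)=a_1\bullet\dots\bullet a_{i-1}\bullet(a_i\circ\Phi_\circ(nw')\circ a_j)\bullet\Phi_\bullet(nw'')$, omitting factors whose index range is empty. The element coming from letter $a_k$ is identified with $k$, so both texts have domain $[n]$, first order the natural order and labeling $\lambda(k)=a_k$. $x\ge_2 y$ means $y\le_2 x$. -}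

module Defs where

open import Data.Nat using (ℕ; zero; suc; pred; _≤_; _<_; _≟_; _≤?_; _<?_; _%_)
open import Data.Nat.Properties using ()
open import Data.Product using (_×_; _,_; Σ; ∃; ∃-syntax)
open import Data.Sum using (_⊎_)
open import Data.Bool using (Bool; true; false; _∧_)
open import Data.List using (List; []; _∷_; _++_; filter; length)
open import Data.List.Membership.Propositional using (_∈_)
open import Data.List.Relation.Unary.All using (All)
open import Data.List.Relation.Unary.Unique.Propositional using (Unique)
open import Data.Maybe using (Maybe; just; nothing)
open import Data.Vec using (Vec)
open import Data.Empty using (⊥)
open import Relation.Binary.PropositionalEquality using (_≡_)
open import Relation.Nullary using (yes; no; ¬_)
open import Relation.Nullary.Decidable using (⌊_⌋)

-- Nested words.  Positions are the naturals 1 … n.  A nesting relation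
-- (a finite binary relation on [n]) is represented as a duplicate-free
-- list of pairs; (i , j) ∈ ν means ν(i,j).

IsNestingRelation : ℕ → List (ℕ × ℕ) → Set
IsNestingRelation n ν =
  Unique ν
  × All (λ p → 1 ≤ Data.Product.proj₁ p × Data.Product.proj₂ p ≤ n) ν
  × (∀ {i j} → (i , j) ∈ ν → i < j)
  × (∀ {i j j'} → (i , j) ∈ ν → (i , j') ∈ ν → j ≡ j')
  × (∀ {i i' j} → (i , j) ∈ ν → (i' , j) ∈ ν → i ≡ i')
  × (∀ {i j i' j'} → (i , j) ∈ ν → (i' , j') ∈ ν → i < i' → j < i' ⊎ j' < j)

record NestedWord (Δ : Set) : Set where
  field
    n    : ℕ
    n≥1  : 1 ≤ n
    word : Vec Δ n                 -- a_k is the (k-1)-th entry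
    ν    : List (ℕ × ℕ)
    isNesting : IsNestingRelation n ν

depth : List (ℕ × ℕ) → ℕ → ℕ
depth ν k = length (filter (λ p → (Data.Product.proj₁ p ≤? k) Relation.Nullary.×-dec (k <? Data.Product.proj₂ p)) ν)

-- Texts over domain ⊆ ℕ, built by the two compositions ∘ and •.
-- (Only the second order matters here; the first order of every text
-- produced below is the natural order and the labelling is k ↦ a_k.)

data Tx : Set where
  leaf   : ℕ → Tx
  _⊙_    : Tx → Tx → Tx
  _⊛_    : Tx → Tx → Tx

dom : Tx → List ℕ
dom (leaf k) = k ∷ []
dom (a ⊙ b) = dom a ++ dom b
dom (a ⊛ b) = dom a ++ dom b

data _⊢_≤₂_ : Tx → ℕ → ℕ → Set where
  refl₂ : ∀ {k} → leaf k ⊢ k ≤₂ k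
  ⊙ˡ : ∀ {a b x y} → a ⊢ x ≤₂ y → (a ⊙ b) ⊢ x ≤₂ y
  ⊙ʳ : ∀ {a b x y} → b ⊢ x ≤₂ y → (a ⊙ b) ⊢ x ≤₂ y
  ⊙× : ∀ {a b x y} → x ∈ dom a → y ∈ dom b → (a ⊙ b) ⊢ x ≤₂ y
  ⊛ˡ : ∀ {a b x y} → a ⊢ x ≤₂ y → (a ⊛ b) ⊢ x ≤₂ y
  ⊛ʳ : ∀ {a b x y} → b ⊢ x ≤₂ y → (a ⊛ b) ⊢ x ≤₂ y
  ⊛× : ∀ {a b x y} → x ∈ dom b → y ∈ dom a → (a ⊛ b) ⊢ x ≤₂ y

data Mode : Set where
  circ bullet : Mode

other : Mode → Mode
other circ = bullet
other bullet = circ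

join : Mode → Tx → Tx → Tx
join circ a b = a ⊙ b
join bullet a b = a ⊛ b

-- composition omitting empty factors
joinM : Mode → Maybe Tx → Maybe Tx → Maybe Tx
joinM m nothing b = b
joinM m (just a) nothing = just a
joinM m (just a) (just b) = just (join m a b)

partner : List (ℕ × ℕ) → ℕ → Maybe ℕ
partner [] k = nothing
partner ((p , q) ∷ ν) k with p ≟ k
... | yes _ = just q
... | no  _ = partner ν k

-- enc ν m fuel lo hi : Φ_m of the subword nw[lo,hi] (elements named by
-- their absolute positions), nothing if the range is empty.  Scanning
-- from lo: letters before the minimal call position of nw[lo,hi] are
-- composed one by one with m; at the minimal call position i with
-- partner j (j ≤ hi, i.e. the pair lies in nw[lo,hi]) we produce
-- (a_i m' Φ_m'(nw[i+1,j-1]) m' a_j) m Φ_m(nw[j+1,hi]).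
-- This is exactly the paper's definition (ν = ∅ case included), with
-- the m-composition bracketed to the right (it is associative).
enc : List (ℕ × ℕ) → Mode → ℕ → ℕ → ℕ → Maybe Tx
enc ν m zero lo hi = nothing
enc ν m (suc f) lo hi with hi <? lo
... | yes _ = nothing
... | no  _ with partner ν lo
...   | nothing = joinM m (just (leaf lo)) (enc ν m f (suc lo) hi)
...   | just q with q ≤? hi
...     | no  _ = joinM m (just (leaf lo)) (enc ν m f (suc lo) hi)
...     | yes _ =
          joinM m
            (joinM (other m)
               (joinM (other m) (just (leaf lo)) (enc ν (other m) f (suc lo) (pred q)))
               (just (leaf q)))
            (enc ν m f (suc q) hi)

module _ {Δ : Set} (nw : NestedWord Δ) where
  open NestedWord nw

  Φ∘ : Maybe Tx
  Φ∘ = enc ν circ n 1 n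

  Φ• : Maybe Tx
  Φ• = enc ν bullet n 1 n

Le₂ : Maybe Tx → ℕ → ℕ → Set
Le₂ nothing x y = ⊥
Le₂ (just t) x y = t ⊢ x ≤₂ y

module Submission where

open import Defs
open import Data.Nat using (ℕ; zero; suc; pred; _+_; _≤_; _<_; _%_; z≤n; s≤s; _≤?_; _<?_; _≟_)
open import Data.Nat.Properties
open import Data.Product using (_×_; _,_; ∃-syntax; proj₁; proj₂)
open import Data.Sum using (_⊎_; inj₁; inj₂; [_,_]′)
open import Data.Empty using (⊥; ⊥-elim)
open import Data.Unit using (⊤; tt)
open import Data.Maybe using (Maybe; just; nothing)
open import Data.Maybe.Properties using (just-injective)
open import Data.List using (List; []; _∷_; filter; length)
open import Data.List.Properties using (filter-none)
open import Data.List.Membership.Propositional using (_∈_)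
open import Data.List.Membership.Propositional.Properties using (∈-++⁺ˡ; ∈-++⁺ʳ; ∈-++⁻; ∈-filter⁺; ∈-filter⁻)
open import Data.List.Relation.Unary.Any using (here; there)
open import Data.List.Relation.Unary.All as All using (All)
open import Data.List.Relation.Unary.AllPairs using (_∷_)
open import Data.List.Relation.Unary.Unique.Propositional using (Unique)
open import Data.List.Relation.Binary.Disjoint.Propositional using (Disjoint)
open import Data.List.Extrema.Nat using (argmax; argmax-all; f[xs]≤f[argmax])
open import Relation.Binary.PropositionalEquality using (_≡_; refl; sym; trans; cong; subst)
open import Relation.Binary.Structures using (IsEquivalence)
open import Relation.Nullary using (¬_; yes; no; contradiction; _×-dec_)
open import Relation.Unary using (Decidable)
open import Function.Bundles using (_⇔_; mk⇔)
open import Function.Properties.Equivalence using (⇔-isEquivalence)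

-- Let nw[lo,hi] be a subword closed under ν and lo ≤ x < y ≤ hi.  Call a
-- pair (p , q) ∈ ν enclosing x and y if lo ≤ p ≤ x and y ≤ q.  Each such pair
-- is a call block of the recursive encoding containing both positions, and
-- each block exchanges the roles of ∘ and •.  Hence the central invariant
-- (enc-encodes): Φ_m(nw[lo,hi]) is a well-formed text on exactly
-- {lo,…,hi} in which x ≤₂ y if m switched once per enclosing pair is ∘,
-- and y ≤₂ x if it is •.
-- As ≤₂ is antisymmetric on well-formed texts, (a) and (b) are both
-- equivalent to i and j having an odd number of enclosing pairs.  For (c),
-- the enclosing pair with the largest call position is the innermost one,
-- and the depth of an innermost pair is exactly the number of enclosing
-- pairs.

count : {A : Set} {P : A → Set} → Decidable P → List A → ℕ
count P? xs = length (filter P? xs)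

module _ {A : Set} where

  count-ext : {P Q : A → Set} (P? : Decidable P) (Q? : Decidable Q) (xs : List A) →
    (∀ {a} → a ∈ xs → P a → Q a) → (∀ {a} → a ∈ xs → Q a → P a) →
    count P? xs ≡ count Q? xs
  count-ext P? Q? [] f g = refl
  count-ext P? Q? (a ∷ as) f g with P? a | Q? a
  ... | yes _ | yes _ = cong suc (count-ext P? Q? as (λ m → f (there m)) (λ m → g (there m)))
  ... | yes p | no ¬q = contradiction (f (here refl) p) ¬q
  ... | no ¬p | yes q = contradiction (g (here refl) q) ¬p
  ... | no _  | no _  = count-ext P? Q? as (λ m → f (there m)) (λ m → g (there m))

  count-none : {P : A → Set} (P? : Decidable P) (xs : List A) →
    (∀ {a} → a ∈ xs → ¬ P a) → count P? xs ≡ 0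
  count-none P? _ none = cong length (filter-none P? (All.tabulate none))

  count-one : {P : A → Set} (P? : Decidable P) {xs : List A} {a : A} → Unique xs →
    a ∈ xs → P a → (∀ {b} → b ∈ xs → P b → b ≡ a) → count P? xs ≡ 1
  count-one P? {b ∷ bs} (b∉bs ∷ _) (here refl) pa only with P? b
  ... | yes _ = cong suc (count-none P? bs (λ m pc → All.lookup b∉bs m (sym (only (there m) pc))))
  ... | no ¬pa = contradiction pa ¬pa
  count-one P? {b ∷ bs} (b∉bs ∷ u) (there a∈bs) pa only with P? b
  ... | yes pb = contradiction (only (here refl) pb) (All.lookup b∉bs a∈bs)
  ... | no _ = count-one P? u a∈bs pa (λ m pc → only (there m) pc)

  count-split : {P Q R : A → Set} (P? : Decidable P) (Q? : Decidable Q) (R? : Decidable R)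
    (xs : List A) → (∀ {a} → P a → Q a ⊎ R a) → (∀ {a} → Q a ⊎ R a → P a) →
    (∀ {a} → Q a → ¬ R a) → count P? xs ≡ count Q? xs + count R? xs
  count-split P? Q? R? [] _ _ _ = refl
  count-split P? Q? R? (a ∷ as) split merge apart
    with P? a | Q? a | R? a | count-split P? Q? R? as split merge apart
  ... | yes _  | yes qa | yes ra | _  = contradiction ra (apart qa)
  ... | yes _  | yes _  | no _   | ih = cong suc ih
  ... | yes _  | no _   | yes _  | ih = trans (cong suc ih) (sym (+-suc _ _))
  ... | yes pa | no ¬qa | no ¬ra | _  = ⊥-elim ([ ¬qa , ¬ra ]′ (split pa))
  ... | no ¬pa | yes qa | _      | _  = contradiction (merge (inj₁ qa)) ¬pa
  ... | no ¬pa | no _   | yes ra | _  = contradiction (merge (inj₂ ra)) ¬pa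
  ... | no _   | no _   | no _   | ih = ih

  count-argmax : {P : A → Set} (P? : Decidable P) (key : A → ℕ) (xs : List A) →
    ¬ count P? xs ≡ 0 →
    ∃[ a ] (a ∈ xs × P a × (∀ {b} → b ∈ xs → P b → key b ≤ key a))
  count-argmax {P} P? key xs nonzero with filter P? xs in eq
  ... | [] = contradiction refl nonzero
  ... | c ∷ cs = best , proj₁ best-counted , proj₂ best-counted , maximal
    where
    counted : ∀ {b} → b ∈ c ∷ cs → b ∈ xs × P b
    counted m = ∈-filter⁻ P? (subst (_ ∈_) (sym eq) m)
    best : A
    best = argmax key c (c ∷ cs)
    best-counted : best ∈ xs × P best
    best-counted = argmax-all key (counted (here refl)) (All.tabulate counted)
    maximal : ∀ {b} → b ∈ xs → P b → key b ≤ key best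
    maximal b∈xs pb = All.lookup (f[xs]≤f[argmax] {f = key} c (c ∷ cs))
                                 (subst (_ ∈_) eq (∈-filter⁺ P? b∈xs pb))

switch : ℕ → Mode → Mode
switch zero m = m
switch (suc c) m = switch c (other m)

switch-odd : ∀ c → (switch c bullet ≡ circ ⇔ c % 2 ≡ 1) × (switch c circ ≡ bullet ⇔ c % 2 ≡ 1)
switch-odd zero = mk⇔ (λ ()) (λ ()) , mk⇔ (λ ()) (λ ())
switch-odd (suc zero) = mk⇔ (λ _ → refl) (λ _ → refl) , mk⇔ (λ _ → refl) (λ _ → refl)
switch-odd (suc (suc c)) = switch-odd c

-- The compositions τ ∘ τ' and τ • τ' are defined only for disjoint domains;
-- a text term is well formed when all its compositions respect this.
WellFormed : Tx → Set
WellFormed (leaf k) = ⊤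
WellFormed (a ⊙ b) = WellFormed a × WellFormed b × Disjoint (dom a) (dom b)
WellFormed (a ⊛ b) = WellFormed a × WellFormed b × Disjoint (dom a) (dom b)

≤₂-lower : ∀ {t x y} → t ⊢ x ≤₂ y → x ∈ dom t
≤₂-lower refl₂ = here refl
≤₂-lower (⊙ˡ d) = ∈-++⁺ˡ (≤₂-lower d)
≤₂-lower {a ⊙ _} (⊙ʳ d) = ∈-++⁺ʳ (dom a) (≤₂-lower d)
≤₂-lower (⊙× x∈a _) = ∈-++⁺ˡ x∈a
≤₂-lower (⊛ˡ d) = ∈-++⁺ˡ (≤₂-lower d)
≤₂-lower {a ⊛ _} (⊛ʳ d) = ∈-++⁺ʳ (dom a) (≤₂-lower d)
≤₂-lower {a ⊛ _} (⊛× x∈b _) = ∈-++⁺ʳ (dom a) x∈b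

≤₂-upper : ∀ {t x y} → t ⊢ x ≤₂ y → y ∈ dom t
≤₂-upper refl₂ = here refl
≤₂-upper (⊙ˡ d) = ∈-++⁺ˡ (≤₂-upper d)
≤₂-upper {a ⊙ _} (⊙ʳ d) = ∈-++⁺ʳ (dom a) (≤₂-upper d)
≤₂-upper {a ⊙ _} (⊙× _ y∈b) = ∈-++⁺ʳ (dom a) y∈b
≤₂-upper (⊛ˡ d) = ∈-++⁺ˡ (≤₂-upper d)
≤₂-upper {a ⊛ _} (⊛ʳ d) = ∈-++⁺ʳ (dom a) (≤₂-upper d)
≤₂-upper (⊛× _ y∈a) = ∈-++⁺ˡ y∈a

-- The second order of a well-formed text is antisymmetric: two related
-- elements taken from different factors are related in one direction only.
≤₂-antisym : ∀ {t x y} → WellFormed t → t ⊢ x ≤₂ y → t ⊢ y ≤₂ x → x ≡ y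
≤₂-antisym _ refl₂ refl₂ = refl
≤₂-antisym (wa , _ , _) (⊙ˡ d) (⊙ˡ e) = ≤₂-antisym wa d e
≤₂-antisym (_ , _ , ab) (⊙ˡ d) (⊙ʳ e) = ⊥-elim (ab (≤₂-lower d , ≤₂-upper e))
≤₂-antisym (_ , _ , ab) (⊙ˡ d) (⊙× _ x∈b) = ⊥-elim (ab (≤₂-lower d , x∈b))
≤₂-antisym (_ , _ , ab) (⊙ʳ d) (⊙ˡ e) = ⊥-elim (ab (≤₂-upper e , ≤₂-lower d))
≤₂-antisym (_ , wb , _) (⊙ʳ d) (⊙ʳ e) = ≤₂-antisym wb d e
≤₂-antisym (_ , _ , ab) (⊙ʳ d) (⊙× y∈a _) = ⊥-elim (ab (y∈a , ≤₂-upper d))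
≤₂-antisym (_ , _ , ab) (⊙× _ y∈b) (⊙ˡ e) = ⊥-elim (ab (≤₂-lower e , y∈b))
≤₂-antisym (_ , _ , ab) (⊙× x∈a _) (⊙ʳ e) = ⊥-elim (ab (x∈a , ≤₂-upper e))
≤₂-antisym (_ , _ , ab) (⊙× x∈a _) (⊙× _ x∈b) = ⊥-elim (ab (x∈a , x∈b))
≤₂-antisym (wa , _ , _) (⊛ˡ d) (⊛ˡ e) = ≤₂-antisym wa d e
≤₂-antisym (_ , _ , ab) (⊛ˡ d) (⊛ʳ e) = ⊥-elim (ab (≤₂-lower d , ≤₂-upper e))
≤₂-antisym (_ , _ , ab) (⊛ˡ d) (⊛× y∈b _) = ⊥-elim (ab (≤₂-upper d , y∈b))
≤₂-antisym (_ , _ , ab) (⊛ʳ d) (⊛ˡ e) = ⊥-elim (ab (≤₂-upper e , ≤₂-lower d))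
≤₂-antisym (_ , wb , _) (⊛ʳ d) (⊛ʳ e) = ≤₂-antisym wb d e
≤₂-antisym (_ , _ , ab) (⊛ʳ d) (⊛× _ x∈a) = ⊥-elim (ab (x∈a , ≤₂-lower d))
≤₂-antisym (_ , _ , ab) (⊛× x∈b _) (⊛ˡ e) = ⊥-elim (ab (≤₂-upper e , x∈b))
≤₂-antisym (_ , _ , ab) (⊛× _ y∈a) (⊛ʳ e) = ⊥-elim (ab (y∈a , ≤₂-lower e))
≤₂-antisym (_ , _ , ab) (⊛× x∈b _) (⊛× _ x∈a) = ⊥-elim (ab (x∈a , x∈b))

-- The encoding of an empty subword is absent, so the encodings are
-- partial texts; the notions above extend to them.
domM : Maybe Tx → List ℕ
domM nothing = []
domM (just t) = dom t

WellFormedM : Maybe Tx → Set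
WellFormedM nothing = ⊤
WellFormedM (just t) = WellFormed t

Le₂-antisym : ∀ {mt x y} → WellFormedM mt → Le₂ mt x y → Le₂ mt y x → x ≡ y
Le₂-antisym {just t} = ≤₂-antisym

-- x and y are ordered by ≤₂ the way a composition in mode m orders an
-- element of its first factor and one of its second.
Oriented : Mode → Maybe Tx → ℕ → ℕ → Set
Oriented circ t x y = Le₂ t x y
Oriented bullet t x y = Le₂ t y x

joinM-dom⁻ : ∀ m a b {z} → z ∈ domM (joinM m a b) → z ∈ domM a ⊎ z ∈ domM b
joinM-dom⁻ m nothing b z∈ = inj₂ z∈
joinM-dom⁻ m (just a) nothing z∈ = inj₁ z∈
joinM-dom⁻ circ (just a) (just b) z∈ = ∈-++⁻ (dom a) z∈
joinM-dom⁻ bullet (just a) (just b) z∈ = ∈-++⁻ (dom a) z∈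

joinM-domˡ : ∀ m a b {z} → z ∈ domM a → z ∈ domM (joinM m a b)
joinM-domˡ m (just a) nothing z∈ = z∈
joinM-domˡ circ (just a) (just b) z∈ = ∈-++⁺ˡ z∈
joinM-domˡ bullet (just a) (just b) z∈ = ∈-++⁺ˡ z∈

joinM-domʳ : ∀ m a b {z} → z ∈ domM b → z ∈ domM (joinM m a b)
joinM-domʳ m nothing b z∈ = z∈
joinM-domʳ circ (just a) (just b) z∈ = ∈-++⁺ʳ (dom a) z∈
joinM-domʳ bullet (just a) (just b) z∈ = ∈-++⁺ʳ (dom a) z∈

joinM-wf : ∀ m a b → WellFormedM a → WellFormedM b → Disjoint (domM a) (domM b) →
  WellFormedM (joinM m a b)
joinM-wf m nothing b _ wb _ = wb
joinM-wf m (just a) nothing wa _ _ = wa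
joinM-wf circ (just a) (just b) wa wb ab = wa , wb , ab
joinM-wf bullet (just a) (just b) wa wb ab = wa , wb , ab

joinM-Leˡ : ∀ m a b {x y} → Le₂ a x y → Le₂ (joinM m a b) x y
joinM-Leˡ m (just a) nothing d = d
joinM-Leˡ circ (just a) (just b) d = ⊙ˡ d
joinM-Leˡ bullet (just a) (just b) d = ⊛ˡ d

joinM-Leʳ : ∀ m a b {x y} → Le₂ b x y → Le₂ (joinM m a b) x y
joinM-Leʳ m nothing b d = d
joinM-Leʳ circ (just a) (just b) d = ⊙ʳ d
joinM-Leʳ bullet (just a) (just b) d = ⊛ʳ d

Oriented-joinˡ : ∀ o m a b {x y} → Oriented o a x y → Oriented o (joinM m a b) x y
Oriented-joinˡ circ m a b d = joinM-Leˡ m a b d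
Oriented-joinˡ bullet m a b d = joinM-Leˡ m a b d

Oriented-joinʳ : ∀ o m a b {x y} → Oriented o b x y → Oriented o (joinM m a b) x y
Oriented-joinʳ circ m a b d = joinM-Leʳ m a b d
Oriented-joinʳ bullet m a b d = joinM-Leʳ m a b d

Oriented-across : ∀ m a b {x y} → x ∈ domM a → y ∈ domM b → Oriented m (joinM m a b) x y
Oriented-across circ (just a) (just b) x∈a y∈b = ⊙× x∈a y∈b
Oriented-across bullet (just a) (just b) x∈a y∈b = ⊛× y∈b x∈a

record Encodes (lo hi : ℕ) (o : ℕ → ℕ → Mode) (mt : Maybe Tx) : Set where
  field
    dom⁻ : ∀ {z} → z ∈ domM mt → lo ≤ z × z ≤ hi
    dom⁺ : ∀ {z} → lo ≤ z → z ≤ hi → z ∈ domM mt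
    wf : WellFormedM mt
    ori : ∀ {x y} → lo ≤ x → x < y → y ≤ hi → Oriented (o x y) mt x y

encodes-empty : ∀ {lo hi o} → hi < lo → Encodes lo hi o nothing
encodes-empty hi<lo = record
  { dom⁻ = λ ()
  ; dom⁺ = λ lo≤z z≤hi → contradiction (≤-trans lo≤z z≤hi) (<⇒≱ hi<lo)
  ; wf = tt
  ; ori = λ lo≤x x<y y≤hi → contradiction (≤-trans lo≤x (≤-trans (<⇒≤ x<y) y≤hi)) (<⇒≱ hi<lo)
  }

encodes-leaf : ∀ {k o} → Encodes k k o (just (leaf k))
encodes-leaf = record
  { dom⁻ = λ { (here refl) → ≤-refl , ≤-refl }
  ; dom⁺ = λ k≤z z≤k → here (≤-antisym z≤k k≤z)
  ; wf = tt
  ; ori = λ k≤x x<y y≤k → contradiction (≤-trans y≤k k≤x) (<⇒≱ x<y)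
  }

encodes-join : ∀ {m lo mid hi} {oa ob o : ℕ → ℕ → Mode} {a b} → lo ≤ suc mid → mid ≤ hi →
  Encodes lo mid oa a → Encodes (suc mid) hi ob b →
  (∀ {x y} → lo ≤ x → x < y → y ≤ mid → o x y ≡ oa x y) →
  (∀ {x y} → mid < x → x < y → y ≤ hi → o x y ≡ ob x y) →
  (∀ {x y} → lo ≤ x → x ≤ mid → mid < y → y ≤ hi → o x y ≡ m) →
  Encodes lo hi o (joinM m a b)
encodes-join {m} {lo} {mid} {hi} {oa} {ob} {o} {a} {b} lo≤mid+1 mid≤hi A B inA inB across =
  record { dom⁻ = dom⁻ ; dom⁺ = dom⁺ ; wf = wf ; ori = ori }
  where
  module A = Encodes A
  module B = Encodes B
  J : Maybe Tx
  J = joinM m a b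
  dom⁻ : ∀ {z} → z ∈ domM J → lo ≤ z × z ≤ hi
  dom⁻ z∈ with joinM-dom⁻ m a b z∈
  ... | inj₁ z∈a = proj₁ (A.dom⁻ z∈a) , ≤-trans (proj₂ (A.dom⁻ z∈a)) mid≤hi
  ... | inj₂ z∈b = ≤-trans lo≤mid+1 (proj₁ (B.dom⁻ z∈b)) , proj₂ (B.dom⁻ z∈b)
  dom⁺ : ∀ {z} → lo ≤ z → z ≤ hi → z ∈ domM J
  dom⁺ {z} lo≤z z≤hi with z ≤? mid
  ... | yes z≤mid = joinM-domˡ m a b (A.dom⁺ lo≤z z≤mid)
  ... | no z≰mid = joinM-domʳ m a b (B.dom⁺ (≰⇒> z≰mid) z≤hi)
  wf : WellFormedM J
  wf = joinM-wf m a b A.wf B.wf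
         (λ (z∈a , z∈b) → <⇒≱ (proj₁ (B.dom⁻ z∈b)) (proj₂ (A.dom⁻ z∈a)))
  ori : ∀ {x y} → lo ≤ x → x < y → y ≤ hi → Oriented (o x y) J x y
  ori {x} {y} lo≤x x<y y≤hi with y ≤? mid | x ≤? mid
  ... | yes y≤mid | _ = subst (λ w → Oriented w J x y) (sym (inA lo≤x x<y y≤mid))
                          (Oriented-joinˡ (oa x y) m a b (A.ori lo≤x x<y y≤mid))
  ... | no y≰mid | yes x≤mid = subst (λ w → Oriented w J x y) (sym (across lo≤x x≤mid (≰⇒> y≰mid) y≤hi))
                                 (Oriented-across m a b (A.dom⁺ lo≤x x≤mid) (B.dom⁺ (≰⇒> y≰mid) y≤hi))
  ... | no _ | no x≰mid = subst (λ w → Oriented w J x y) (sym (inB (≰⇒> x≰mid) x<y y≤hi))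
                            (Oriented-joinʳ (ob x y) m a b (B.ori (≰⇒> x≰mid) x<y y≤hi))

encodes-order : ∀ {lo hi o mt x y} → Encodes lo hi o mt → lo ≤ x → x < y → y ≤ hi →
  (Le₂ mt x y ⇔ o x y ≡ circ) × (Le₂ mt y x ⇔ o x y ≡ bullet)
encodes-order {o = o} {mt} {x} {y} E lo≤x x<y y≤hi = by-mode (o x y) (Encodes.ori E lo≤x x<y y≤hi)
  where
  not-both : Le₂ mt x y → Le₂ mt y x → ⊥
  not-both x≤y y≤x = <⇒≢ x<y (Le₂-antisym {mt} (Encodes.wf E) x≤y y≤x)
  by-mode : ∀ w → Oriented w mt x y → (Le₂ mt x y ⇔ w ≡ circ) × (Le₂ mt y x ⇔ w ≡ bullet)
  by-mode circ x≤y = mk⇔ (λ _ → refl) (λ _ → x≤y) , mk⇔ (λ y≤x → ⊥-elim (not-both x≤y y≤x)) (λ ())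
  by-mode bullet y≤x = mk⇔ (λ x≤y → ⊥-elim (not-both x≤y y≤x)) (λ ()) , mk⇔ (λ _ → refl) (λ _ → y≤x)

partner-just : ∀ ν k q → partner ν k ≡ just q → (k , q) ∈ ν
partner-just ((p , r) ∷ ν) k q found with p ≟ k
... | yes refl = here (cong (k ,_) (sym (just-injective found)))
... | no _ = there (partner-just ν k q found)

partner-nothing : ∀ ν k {q} → partner ν k ≡ nothing → ¬ (k , q) ∈ ν
partner-nothing ((p , r) ∷ ν) k none k∈ with p ≟ k
partner-nothing ((p , r) ∷ ν) k () k∈ | yes _
partner-nothing ((p , r) ∷ ν) k none (here refl) | no p≢k = p≢k refl
partner-nothing ((p , r) ∷ ν) k none (there k∈) | no _ = partner-nothing ν k none k∈

-- Facts about a relation with the properties of a nesting relation.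
module Nesting (ν : List (ℕ × ℕ)) (ν-unique : Unique ν)
  (call<return : ∀ {i j} → (i , j) ∈ ν → i < j)
  (return-unique : ∀ {i j j'} → (i , j) ∈ ν → (i , j') ∈ ν → j ≡ j')
  (well-nested : ∀ {i j i' j'} → (i , j) ∈ ν → (i' , j') ∈ ν → i < i' → j < i' ⊎ j' < j) where

  Encloses : ℕ → ℕ → ℕ → ℕ × ℕ → Set
  Encloses lo x y (p , q) = lo ≤ p × p ≤ x × y ≤ q

  Encloses? : ∀ lo x y → Decidable (Encloses lo x y)
  Encloses? lo x y (p , q) = (lo ≤? p) ×-dec ((p ≤? x) ×-dec (y ≤? q))

  enclosing : ℕ → ℕ → ℕ → ℕ
  enclosing lo x y = count (Encloses? lo x y) ν

  OpensAt : ℕ → ℕ → ℕ × ℕ → Set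
  OpensAt lo y (p , q) = p ≡ lo × y ≤ q

  OpensAt? : ∀ lo y → Decidable (OpensAt lo y)
  OpensAt? lo y (p , q) = (p ≟ lo) ×-dec (y ≤? q)

  enclosing-split : ∀ {lo x y} → lo ≤ x →
    enclosing lo x y ≡ count (OpensAt? lo y) ν + enclosing (suc lo) x y
  enclosing-split {lo} {x} {y} lo≤x =
    count-split (Encloses? lo x y) (OpensAt? lo y) (Encloses? (suc lo) x y) ν to from apart
    where
    to : ∀ {pr} → Encloses lo x y pr → OpensAt lo y pr ⊎ Encloses (suc lo) x y pr
    to (lo≤p , p≤x , y≤q) with m≤n⇒m<n∨m≡n lo≤p
    ... | inj₁ lo<p = inj₂ (lo<p , p≤x , y≤q)
    ... | inj₂ refl = inj₁ (refl , y≤q)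
    from : ∀ {pr} → OpensAt lo y pr ⊎ Encloses (suc lo) x y pr → Encloses lo x y pr
    from (inj₁ (refl , y≤q)) = ≤-refl , lo≤x , y≤q
    from (inj₂ (lo<p , p≤x , y≤q)) = <⇒≤ lo<p , p≤x , y≤q
    apart : ∀ {pr} → OpensAt lo y pr → ¬ Encloses (suc lo) x y pr
    apart (refl , _) (lo<lo , _) = <-irrefl refl lo<lo

  enclosing-noCall : ∀ {lo x y} → (∀ {q} → ¬ (lo , q) ∈ ν) → lo ≤ x →
    enclosing lo x y ≡ enclosing (suc lo) x y
  enclosing-noCall {lo} {x} {y} no-call lo≤x = trans (enclosing-split lo≤x)
    (cong (_+ enclosing (suc lo) x y)
          (count-none (OpensAt? lo y) ν λ { {p , q} call (refl , _) → no-call call }))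

  enclosing-call : ∀ {lo q x y} → (lo , q) ∈ ν → lo ≤ x → y ≤ q →
    enclosing lo x y ≡ suc (enclosing (suc lo) x y)
  enclosing-call {lo} {q} {x} {y} call lo≤x y≤q = trans (enclosing-split lo≤x)
    (cong (_+ enclosing (suc lo) x y)
          (count-one (OpensAt? lo y) ν-unique call (refl , y≤q)
                     λ { {p , q'} call' (refl , _) → cong (lo ,_) (return-unique call' call) }))

  enclosing-before : ∀ {lo x y} → x < lo → enclosing lo x y ≡ 0
  enclosing-before x<lo = count-none (Encloses? _ _ _) ν
    λ { {p , q} _ (lo≤p , p≤x , _) → <⇒≱ x<lo (≤-trans lo≤p p≤x) }

  return-within : ∀ {lo q p q'} → (lo , q) ∈ ν → (p , q') ∈ ν → lo ≤ p → p ≤ q → q' ≤ q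
  return-within call call' lo≤p p≤q with m≤n⇒m<n∨m≡n lo≤p
  ... | inj₁ lo<p = [ (λ q<p → contradiction p≤q (<⇒≱ q<p)) , <⇒≤ ]′ (well-nested call call' lo<p)
  ... | inj₂ refl = ≤-reflexive (return-unique call' call)

  enclosing-inside : ∀ {lo q x y} → (lo , q) ∈ ν → x < q → q ≤ y → enclosing (suc lo) x y ≡ 0
  enclosing-inside call x<q q≤y = count-none (Encloses? _ _ _) ν
    λ { {p , q'} call' (lo<p , p≤x , y≤q') →
        [ (λ q<p → <⇒≱ q<p (≤-trans p≤x (<⇒≤ x<q))) , (λ q'<q → <⇒≱ q'<q (≤-trans q≤y y≤q')) ]′
          (well-nested call call' lo<p) }

  enclosing-after : ∀ {lo q x y} → (lo , q) ∈ ν → q < x → x < y →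
    enclosing lo x y ≡ enclosing (suc q) x y
  enclosing-after {lo} {q} {x} {y} call q<x x<y =
    count-ext (Encloses? lo x y) (Encloses? (suc q) x y) ν to from
    where
    to : ∀ {pr} → pr ∈ ν → Encloses lo x y pr → Encloses (suc q) x y pr
    to {p , q'} call' (lo≤p , p≤x , y≤q') with p ≤? q
    ... | yes p≤q = contradiction (≤-trans y≤q' (return-within call call' lo≤p p≤q)) (<⇒≱ (<-trans q<x x<y))
    ... | no p≰q = ≰⇒> p≰q , p≤x , y≤q'
    from : ∀ {pr} → pr ∈ ν → Encloses (suc q) x y pr → Encloses lo x y pr
    from _ (q<p , p≤x , y≤q') = ≤-trans (<⇒≤ (call<return call)) (<⇒≤ q<p) , p≤x , y≤q'

  enclosing-straddle : ∀ {lo q x y} → (lo , q) ∈ ν → x ≤ q → q < y → enclosing lo x y ≡ 0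
  enclosing-straddle call x≤q q<y = count-none (Encloses? _ _ _) ν
    λ { {p , q'} call' (lo≤p , p≤x , y≤q') →
        <⇒≱ q<y (≤-trans y≤q' (return-within call call' lo≤p (≤-trans p≤x x≤q))) }

  -- The orientation of x < y in Φ_m(nw[lo,hi]): the mode m, switched once
  -- for every pair opened in the subword that encloses x and y.
  orient : Mode → ℕ → ℕ → ℕ → Mode
  orient m lo x y = switch (enclosing lo x y) m

  Closed : ℕ → ℕ → Set
  Closed lo hi = ∀ {p q} → (p , q) ∈ ν → lo ≤ p → p ≤ hi → q ≤ hi

  closed-inside : ∀ {lo q} → (lo , q) ∈ ν → Closed (suc lo) (pred q)
  closed-inside call call' lo<p p≤q-1 =
    [ (λ q<p → contradiction (≤pred⇒≤ p≤q-1) (<⇒≱ q<p)) , suc[m]≤n⇒m≤pred[n] ]′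
      (well-nested call call' lo<p)

  fuel-step : ∀ {f lo lo' hi} → hi < suc f + lo → lo ≤ lo' → hi < f + suc lo'
  fuel-step {f} {lo} hi<fuel lo≤lo' =
    <-≤-trans hi<fuel (≤-trans (≤-reflexive (sym (+-suc f lo))) (+-monoʳ-≤ f (s≤s lo≤lo')))

  encodes-letter : ∀ {m lo hi rest} → (∀ {q} → ¬ (lo , q) ∈ ν) → lo ≤ hi →
    Encodes (suc lo) hi (orient m (suc lo)) rest →
    Encodes lo hi (orient m lo) (joinM m (just (leaf lo)) rest)
  encodes-letter {m} {lo} no-call lo≤hi R = encodes-join (n≤1+n _) lo≤hi (encodes-leaf {o = orient m lo}) R
    (λ lo≤x x<y y≤lo → contradiction (≤-trans y≤lo lo≤x) (<⇒≱ x<y))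
    (λ lo<x _ _ → cong (λ c → switch c m) (enclosing-noCall no-call (<⇒≤ lo<x)))
    (λ lo≤x x≤lo _ _ → cong (λ c → switch c m)
                           (trans (enclosing-noCall no-call lo≤x) (enclosing-before (s≤s x≤lo))))

  -- The block a_lo m' Φ_m'(nw[lo+1,q-1]) m' a_q of a call (lo , q), where m'
  -- is the other mode: it is oriented by m, because the call itself is
  -- the one extra pair enclosing its positions.
  encodes-block : ∀ {m lo q inner} → (lo , q) ∈ ν →
    Encodes (suc lo) (pred q) (orient (other m) (suc lo)) inner →
    Encodes lo q (orient m lo) (joinM (other m) (joinM (other m) (just (leaf lo)) inner) (just (leaf q)))
  encodes-block {q = zero} call _ = contradiction (call<return call) λ ()
  encodes-block {m} {lo} {suc q} {inner} call I =
    encodes-join (≤-trans lo≤q (n≤1+n _)) (n≤1+n _) opened (encodes-leaf {o = orient m lo})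
      (λ _ _ _ → refl)
      (λ q<x x<y y≤q+1 → contradiction (≤-trans y≤q+1 q<x) (<⇒≱ x<y))
      (λ lo≤x x≤q q<y y≤q+1 → cong (λ c → switch c m)
          (trans (enclosing-call call lo≤x y≤q+1) (cong suc (enclosing-inside call (s≤s x≤q) q<y))))
    where
    lo≤q : lo ≤ q
    lo≤q = ≤-pred (call<return call)
    opened : Encodes lo q (orient m lo) (joinM (other m) (just (leaf lo)) inner)
    opened = encodes-join (n≤1+n lo) lo≤q (encodes-leaf {o = orient m lo}) I
      (λ lo≤x x<y y≤lo → contradiction (≤-trans y≤lo lo≤x) (<⇒≱ x<y))
      (λ lo<x _ y≤q → cong (λ c → switch c m) (enclosing-call call (<⇒≤ lo<x) (m≤n⇒m≤1+n y≤q)))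
      (λ lo≤x x≤lo _ y≤q → cong (λ c → switch c m)
          (trans (enclosing-call call lo≤x (m≤n⇒m≤1+n y≤q)) (cong suc (enclosing-before (s≤s x≤lo)))))

  encodes-after-block : ∀ {m lo q hi block rest} → (lo , q) ∈ ν → q ≤ hi →
    Encodes lo q (orient m lo) block → Encodes (suc q) hi (orient m (suc q)) rest →
    Encodes lo hi (orient m lo) (joinM m block rest)
  encodes-after-block {m} call q≤hi B R =
    encodes-join (m≤n⇒m≤1+n (<⇒≤ (call<return call))) q≤hi B R
      (λ _ _ _ → refl)
      (λ q<x x<y _ → cong (λ c → switch c m) (enclosing-after call q<x x<y))
      (λ _ x≤q q<y _ → cong (λ c → switch c m) (enclosing-straddle call x≤q q<y))

  enc-encodes : ∀ f m lo hi → Closed lo hi → hi < f + lo →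
    Encodes lo hi (orient m lo) (enc ν m f lo hi)
  enc-encodes zero m lo hi _ hi<lo = encodes-empty hi<lo
  enc-encodes (suc f) m lo hi closed fuel with hi <? lo
  ... | yes hi<lo = encodes-empty hi<lo
  ... | no hi≮lo with partner ν lo in found
  ...   | nothing = encodes-letter (partner-nothing ν lo found) (≮⇒≥ hi≮lo)
                      (enc-encodes f m (suc lo) hi (λ call lo<p → closed call (<⇒≤ lo<p))
                                   (fuel-step fuel ≤-refl))
  ...   | just q with q ≤? hi | partner-just ν lo q found
  ...     | no q≰hi  | call = contradiction (closed call ≤-refl (≮⇒≥ hi≮lo)) q≰hi
  ...     | yes q≤hi | call = encodes-after-block call q≤hi
                                (encodes-block call (enc-encodes f (other m) (suc lo) (pred q)
                                                                 (closed-inside call) inner-fuel))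
                                (enc-encodes f m (suc q) hi rest-closed (fuel-step fuel lo≤q))
    where
    lo≤q : lo ≤ q
    lo≤q = <⇒≤ (call<return call)
    inner-fuel : pred q < f + suc lo
    inner-fuel = ≤-<-trans (≤-trans pred[n]≤n q≤hi) (fuel-step fuel ≤-refl)
    rest-closed : Closed (suc q) hi
    rest-closed call' q<p = closed call' (≤-trans lo≤q (<⇒≤ q<p))

  NoPairWithin : ℕ → ℕ → ℕ → ℕ → Set
  NoPairWithin k l i j = ¬ (∃[ k' ] ∃[ l' ] ((k' , l') ∈ ν × k < k' × k' ≤ i × j ≤ l' × l' < l))

  -- The depth of an innermost pair (k , l) enclosing i < j is the number of
  -- all pairs enclosing i and j: a pair opened up to k encloses k iff it
  -- encloses i and j, and no pair opened after k encloses them.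
  depth-innermost : ∀ {i j k l} → (∀ {p q} → (p , q) ∈ ν → 1 ≤ p) → i < j →
    (k , l) ∈ ν → k ≤ i → j ≤ l → NoPairWithin k l i j → depth ν k ≡ enclosing 1 i j
  depth-innermost {i} {j} {k} {l} positive i<j call k≤i j≤l innermost =
    count-ext _ (Encloses? 1 i j) ν to from
    where
    to : ∀ {pr} → pr ∈ ν → proj₁ pr ≤ k × k < proj₂ pr → Encloses 1 i j pr
    to {p , q} call' (p≤k , k<q) with m≤n⇒m<n∨m≡n p≤k
    ... | inj₁ p<k = positive call' , ≤-trans p≤k k≤i ,
          [ (λ q<k → ⊥-elim (<-asym q<k k<q)) , (λ l<q → ≤-trans j≤l (<⇒≤ l<q)) ]′ (well-nested call' call p<k)
    ... | inj₂ refl = positive call' , k≤i , subst (j ≤_) (return-unique call call') j≤l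
    from : ∀ {pr} → pr ∈ ν → Encloses 1 i j pr → proj₁ pr ≤ k × k < proj₂ pr
    from {p , q} call' (_ , p≤i , j≤q) with p ≤? k
    ... | yes p≤k = p≤k , <-≤-trans (≤-<-trans k≤i i<j) j≤q
    ... | no p≰k = ⊥-elim ([ (λ l<p → <⇒≱ l<p (≤-trans (<⇒≤ (≤-<-trans p≤i i<j)) j≤l))
                           , (λ q<l → innermost (p , q , call' , ≰⇒> p≰k , p≤i , j≤q , q<l)) ]′
                             (well-nested call call' (≰⇒> p≰k)))

  InnermostAtOddDepth : ℕ → ℕ → ℕ → Set
  InnermostAtOddDepth n i j = ∃[ k ] ∃[ l ] ((k , l) ∈ ν × 1 ≤ k × k ≤ i × j ≤ l × l ≤ n
    × NoPairWithin k l i j × depth ν k % 2 ≡ 1)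

  -- (c) holds iff i < j are enclosed by an odd number of pairs; for the
  -- converse, the enclosing pair with the largest call position is innermost.
  innermost⇔odd : ∀ {n i j} → All (λ pr → 1 ≤ proj₁ pr × proj₂ pr ≤ n) ν → i < j →
    InnermostAtOddDepth n i j ⇔ enclosing 1 i j % 2 ≡ 1
  innermost⇔odd {n} {i} {j} bounds i<j = mk⇔ to from
    where
    positive : ∀ {p q} → (p , q) ∈ ν → 1 ≤ p
    positive call = proj₁ (All.lookup bounds call)
    to : InnermostAtOddDepth n i j → enclosing 1 i j % 2 ≡ 1
    to (k , l , call , _ , k≤i , j≤l , _ , innermost , odd) =
      subst (λ d → d % 2 ≡ 1) (depth-innermost positive i<j call k≤i j≤l innermost) odd
    from : enclosing 1 i j % 2 ≡ 1 → InnermostAtOddDepth n i j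
    from odd with count-argmax (Encloses? 1 i j) proj₁ ν (λ none → 0≢1+n (subst (λ c → c % 2 ≡ 1) none odd))
    ... | (k , l) , call , (1≤k , k≤i , j≤l) , maximal =
      k , l , call , 1≤k , k≤i , j≤l , proj₂ (All.lookup bounds call) , innermost ,
      subst (λ d → d % 2 ≡ 1) (sym (depth-innermost positive i<j call k≤i j≤l innermost)) odd
      where
      innermost : NoPairWithin k l i j
      innermost (k' , l' , call' , k<k' , k'≤i , j≤l' , _) =
        <⇒≱ k<k' (maximal call' (≤-trans 1≤k (<⇒≤ k<k') , k'≤i , j≤l'))


lemma5p3 : {Δ : Set} (nw : NestedWord Δ) (i j : ℕ) →
    1 ≤ i → i < j → j ≤ NestedWord.n nw →
    (Le₂ (Φ∘ nw) j i ⇔ Le₂ (Φ• nw) i j)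
    × (Le₂ (Φ• nw) i j ⇔
       (∃[ k ] ∃[ l ] ((k , l) ∈ NestedWord.ν nw × 1 ≤ k × k ≤ i × j ≤ l × l ≤ NestedWord.n nw
          × ¬ (∃[ k' ] ∃[ l' ] ((k' , l') ∈ NestedWord.ν nw × k < k' × k' ≤ i × j ≤ l' × l' < l))
          × depth (NestedWord.ν nw) k % 2 ≡ 1)))
lemma5p3 nw i j 1≤i i<j j≤n with NestedWord.isNesting nw
... | ν-unique , bounds , call<return , return-unique , _ , well-nested =
  ⇔.trans circ⇔odd (⇔.sym bullet⇔odd) , ⇔.trans bullet⇔odd (⇔.sym (innermost⇔odd bounds i<j))
  where
  open NestedWord nw using (n; ν)
  open Nesting ν ν-unique call<return return-unique well-nested
  module ⇔ = IsEquivalence ⇔-isEquivalence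
  encodes : ∀ m → Encodes 1 n (orient m 1) (enc ν m n 1 n)
  encodes m = enc-encodes n m 1 n (λ call _ _ → proj₂ (All.lookup bounds call)) (m<m+n n (s≤s z≤n))
  circ⇔odd : Le₂ (Φ∘ nw) j i ⇔ enclosing 1 i j % 2 ≡ 1
  circ⇔odd = ⇔.trans (proj₂ (encodes-order (encodes circ) 1≤i i<j j≤n)) (proj₂ (switch-odd (enclosing 1 i j)))
  bullet⇔odd : Le₂ (Φ• nw) i j ⇔ enclosing 1 i j % 2 ≡ 1
  bullet⇔odd = ⇔.trans (proj₁ (encodes-order (encodes bullet) 1≤i i<j j≤n)) (proj₁ (switch-odd (enclosing 1 i j)))
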